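{- Let $M$ be a balanced marking for $\pi\in S_n$. Then there exists a marking $M'$ for $\pi$ that is both aligned with $\pi$ and balanced.
   Context: $\pi=[\dots a\dots b\dots]$ means $a$ occurs before $b$ in $\pi$; $\pi=[\dots ab\dots]$ means $b$ occurs immediately after $a$. An inversion of $\pi$ is a pair $(a,b)$ with $a>b$ and $\pi=[\dots a\dots b\dots]$. Element $i$ is right if in some inversion $(i,j)$, left if in some inversion $(j,i)$; left-straight if left but not right; right-straight if right but not left; a switchback if both. A marking for $\pi$ is a function $M$ from $\{1,\dots,n\}$ to strings in letters $L,R$ with $M(i)=L$ for left-straight $i$, $M(i)=R$ for right-straight $i$, $M(i)\in\{LR,RL\}$ for switchbacks, and $M(i)=\emptyset$ otherwise. A quadruple $(a,b,c,d)$ is a rec in $\pi$ if $\pi=[\dots a\dots b\dots c\dots d\dots]$ and $\min\{a,b\}>\max\{c,d\}$. Under $M$, $e$ is a left switchback of the rec if $M(e)=RL$, $\pi=[\dots a\dots e\dots b\dots]$, and $e$ is strictly between $c$ and $d$ in value; a right switchback if $M(e)=LR$, $\pi=[\dots c\dots e\dots d\dots]$, and $e$ is strictly between $a$ and $b$ in value. The rec is regular if $a<b$ and $c<d$, irregular otherwise; balanced if it has equally many left and right switchbacks; empty if it has none. $M$ is balanced if every regular rec is balanced and every irregular rec is empty under $M$. $M$ is aligned with $\pi$ if for every pair $a,b$ with $\pi=[\dots ab\dots]$, $M(a)$ beginning with $R$ and $M(b)$ beginning with $L$, the pair $(a,b)$ is an inversion. -}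

module Defs where

open import Data.Nat using (ℕ; suc)
open import Data.Fin using (Fin; toℕ; _<_; _<?_)
open import Data.Fin.Permutation using (Permutation′; _⟨$⟩ʳ_; _⟨$⟩ˡ_)
open import Data.List using (List; []; _∷_; length; filter)
open import Data.Product using (Σ; ∃; _×_; _,_)
open import Data.Sum using (_⊎_)
open import Relation.Nullary using (¬_; Dec; yes; no)
open import Relation.Nullary.Decidable using (_×-dec_; _⊎-dec_)
open import Relation.Binary.PropositionalEquality using (_≡_; refl)
import Data.List.Properties as LP
open import Data.List using (allFin) public

-- A permutation π ∈ S_n is a bijection Fin n ↔ Fin n sending positions to values
-- (values 1..n are represented 0-indexed by Fin n; only their order matters).
-- pos π a is the position at which the value a occurs in π.
pos : ∀ {n} → Permutation′ n → Fin n → Fin n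
pos π a = π ⟨$⟩ˡ a

Before : ∀ {n} → Permutation′ n → Fin n → Fin n → Set
Before π a b = pos π a < pos π b

ImmBefore : ∀ {n} → Permutation′ n → Fin n → Fin n → Set
ImmBefore π a b = toℕ (pos π b) ≡ suc (toℕ (pos π a))

Inversion : ∀ {n} → Permutation′ n → Fin n → Fin n → Set
Inversion π a b = (b < a) × Before π a b

IsRight : ∀ {n} → Permutation′ n → Fin n → Set
IsRight π i = ∃ λ j → Inversion π i j

IsLeft : ∀ {n} → Permutation′ n → Fin n → Set
IsLeft π i = ∃ λ j → Inversion π j i

data Letter : Set where
  L R : Letter

Marking : ℕ → Set
Marking n = Fin n → List Letter

LR RL : List Letter
LR = L ∷ R ∷ []
RL = R ∷ L ∷ []

IsMarking : ∀ {n} → Permutation′ n → Marking n → Set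
IsMarking π M = ∀ i →
    (IsLeft π i → ¬ IsRight π i → M i ≡ L ∷ [])
  × (IsRight π i → ¬ IsLeft π i → M i ≡ R ∷ [])
  × (IsLeft π i → IsRight π i → (M i ≡ LR ⊎ M i ≡ RL))
  × (¬ IsLeft π i → ¬ IsRight π i → M i ≡ [])

IsRec : ∀ {n} → Permutation′ n → Fin n → Fin n → Fin n → Fin n → Set
IsRec π a b c d =
  (Before π a b × Before π b c × Before π c d)
  × (c < a × c < b × d < a × d < b)

StrictlyBetween : ∀ {n} → Fin n → Fin n → Fin n → Set
StrictlyBetween x y z = (y < x × x < z) ⊎ (z < x × x < y)

LeftSwitchback : ∀ {n} → Permutation′ n → Marking n →
                 Fin n → Fin n → Fin n → Fin n → Fin n → Set
LeftSwitchback π M a b c d e =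
  M e ≡ RL × (Before π a e × Before π e b) × StrictlyBetween e c d

RightSwitchback : ∀ {n} → Permutation′ n → Marking n →
                  Fin n → Fin n → Fin n → Fin n → Fin n → Set
RightSwitchback π M a b c d e =
  M e ≡ LR × (Before π c e × Before π e d) × StrictlyBetween e a b

_≟L_ : (x y : Letter) → Dec (x ≡ y)
L ≟L L = yes refl
L ≟L R = no λ ()
R ≟L L = no λ ()
R ≟L R = yes refl

_≟LS_ : (xs ys : List Letter) → Dec (xs ≡ ys)
_≟LS_ = LP.≡-dec _≟L_

between? : ∀ {n} (x y z : Fin n) → Dec (StrictlyBetween x y z)
between? x y z = ((y <? x) ×-dec (x <? z)) ⊎-dec ((z <? x) ×-dec (x <? y))

before? : ∀ {n} (π : Permutation′ n) (a b : Fin n) → Dec (Before π a b)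
before? π a b = pos π a <? pos π b

leftSB? : ∀ {n} (π : Permutation′ n) (M : Marking n) (a b c d e : Fin n) →
          Dec (LeftSwitchback π M a b c d e)
leftSB? π M a b c d e =
  (M e ≟LS RL) ×-dec ((before? π a e ×-dec before? π e b) ×-dec between? e c d)

rightSB? : ∀ {n} (π : Permutation′ n) (M : Marking n) (a b c d e : Fin n) →
           Dec (RightSwitchback π M a b c d e)
rightSB? π M a b c d e =
  (M e ≟LS LR) ×-dec ((before? π c e ×-dec before? π e d) ×-dec between? e a b)

#LeftSB : ∀ {n} → Permutation′ n → Marking n → Fin n → Fin n → Fin n → Fin n → ℕ
#LeftSB {n} π M a b c d = length (filter (leftSB? π M a b c d) (allFin n))

#RightSB : ∀ {n} → Permutation′ n → Marking n → Fin n → Fin n → Fin n → Fin n → ℕ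
#RightSB {n} π M a b c d = length (filter (rightSB? π M a b c d) (allFin n))

Regular : ∀ {n} → Fin n → Fin n → Fin n → Fin n → Set
Regular a b c d = a < b × c < d

RecBalanced : ∀ {n} → Permutation′ n → Marking n → Fin n → Fin n → Fin n → Fin n → Set
RecBalanced π M a b c d = #LeftSB π M a b c d ≡ #RightSB π M a b c d

RecEmpty : ∀ {n} → Permutation′ n → Marking n → Fin n → Fin n → Fin n → Fin n → Set
RecEmpty {n} π M a b c d =
  ∀ (e : Fin n) → ¬ LeftSwitchback π M a b c d e × ¬ RightSwitchback π M a b c d e

IsBalanced : ∀ {n} → Permutation′ n → Marking n → Set
IsBalanced π M = ∀ a b c d → IsRec π a b c d →
  (Regular a b c d → RecBalanced π M a b c d)
  × (¬ Regular a b c d → RecEmpty π M a b c d)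

StartsWith : Letter → List Letter → Set
StartsWith x xs = ∃ λ ys → xs ≡ x ∷ ys

IsAligned : ∀ {n} → Permutation′ n → Marking n → Set
IsAligned π M = ∀ a b → ImmBefore π a b →
  StartsWith R (M a) → StartsWith L (M b) → Inversion π a b

module Submission where

-- Call u, v a conflict of M when π = [... u v ...], u < v, M(u) = RL and M(v) = LR; a marking
-- without conflicts is aligned. A conflict is resolved by exchanging the marks of u and v.
-- This keeps M balanced because u and v lie in the same left and right regions of every rec:
-- otherwise u would be a left switchback, or v a right switchback, of an irregular rec assembled
-- from the given rec and from an inversion (u, j) or (k, v) witnessing that u is right and v left,
-- while irregular recs are empty. Each exchange moves an LR mark one step to the left, so the sum
-- of the positions of LR-marked elements decreases and the process terminates.

open import Defs
open import Algebra.Properties.CommutativeMonoid.Sum as Sum using ()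
open import Data.Bool using (true; false; if_then_else_)
open import Data.Fin as F using (Fin; toℕ; _<_; _≤_)
open import Data.Fin.Properties using (<-trans; <-asym; <-irrefl; <-cmp; <⇒≢; ≤∧≢⇒<; any?)
open import Data.Fin.Permutation using (Permutation′; _⟨$⟩ʳ_; inverseʳ; transpose)
open import Data.List using (List; []; _∷_; length; filter; tabulate; allFin)
open import Data.Nat as ℕ using (ℕ; zero; suc)
open import Data.Nat.Induction using (<-wellFounded)
import Data.Nat.Properties as ℕ
open import Data.Product using (∃; ∃₂; _×_; _,_; proj₁; proj₂)
open import Data.Sum using (_⊎_; inj₁; inj₂; swap)
open import Function using (_∘_; _⇔_; mk⇔; Equivalence)
open import Function.Construct.Identity using (⇔-id)
open import Function.Construct.Symmetry using (⇔-sym)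
open import Induction.WellFounded using (Acc; acc)
open import Relation.Binary using (tri<; tri≈; tri>)
open import Relation.Binary.PropositionalEquality
open import Relation.Nullary using (¬_; Dec; yes; no; does; contradiction)
open import Relation.Nullary.Decidable using (does-⇔; _×-dec_)
open import Relation.Unary using (Pred; Decidable)

open Sum ℕ.+-0-commutativeMonoid using (sum; sum-permute; sum-cong-≗)
open Equivalence using (to; from)

indicator : ∀ {a} {A : Set a} → Dec A → ℕ
indicator a? = if does a? then 1 else 0

length-filter-tabulate : ∀ {a p} {A : Set a} {P : Pred A p} (P? : Decidable P) {m} (f : Fin m → A) →
                         length (filter P? (tabulate f)) ≡ sum (indicator ∘ P? ∘ f)
length-filter-tabulate P? {zero}  f = refl
length-filter-tabulate P? {suc m} f with does (P? (f F.zero))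
... | true  = cong suc (length-filter-tabulate P? (f ∘ F.suc))
... | false = length-filter-tabulate P? (f ∘ F.suc)

sum-mono-≤ : ∀ {m} {f g : Fin m → ℕ} → (∀ i → f i ℕ.≤ g i) → sum f ℕ.≤ sum g
sum-mono-≤ {zero}  f≤g = ℕ.z≤n
sum-mono-≤ {suc m} f≤g = ℕ.+-mono-≤ (f≤g F.zero) (sum-mono-≤ (f≤g ∘ F.suc))

sum-mono-< : ∀ {m} {f g : Fin m → ℕ} → (∀ i → f i ℕ.≤ g i) → ∀ i → f i ℕ.< g i → sum f ℕ.< sum g
sum-mono-< f≤g F.zero    f<g = ℕ.+-mono-<-≤ f<g (sum-mono-≤ (f≤g ∘ F.suc))
sum-mono-< f≤g (F.suc i) f<g = ℕ.+-mono-≤-< (f≤g F.zero) (sum-mono-< (f≤g ∘ F.suc) i f<g)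

module _ {n : ℕ} where

  length-filter-allFin-permute :
    ∀ {p q} {P : Pred (Fin n) p} {Q : Pred (Fin n) q} (P? : Decidable P) (Q? : Decidable Q)
    (σ : Permutation′ n) → (∀ i → P i ⇔ Q (σ ⟨$⟩ʳ i)) →
    length (filter P? (allFin n)) ≡ length (filter Q? (allFin n))
  length-filter-allFin-permute P? Q? σ P⇔Qσ = begin
    length (filter P? (allFin n))       ≡⟨ length-filter-tabulate P? (λ i → i) ⟩
    sum (indicator ∘ P?)                ≡⟨ sum-cong-≗ (λ i → cong (if_then 1 else 0)
                                                        (does-⇔ (P⇔Qσ i) (P? i) (Q? (σ ⟨$⟩ʳ i)))) ⟩
    sum (λ i → indicator (Q? (σ ⟨$⟩ʳ i))) ≡⟨ sum-permute (indicator ∘ Q?) σ ⟨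
    sum (indicator ∘ Q?)                ≡⟨ length-filter-tabulate Q? (λ i → i) ⟨
    length (filter Q? (allFin n))       ∎
    where open ≡-Reasoning

  transpose-⇔ : ∀ {p} {P : Pred (Fin n) p} {u v} → P u ⇔ P v →
                ∀ e → P e ⇔ P (transpose u v ⟨$⟩ʳ e)
  transpose-⇔ {u = u} {v} Pu⇔Pv e with e F.≟ u
  ... | yes refl = Pu⇔Pv
  ... | no _ with e F.≟ v
  ...   | yes refl = ⇔-sym Pu⇔Pv
  ...   | no _     = ⇔-id _

  module _ {e a b : Fin n} where

    strictlyBetween-sym : StrictlyBetween e a b → StrictlyBetween e b a
    strictlyBetween-sym = swap

    strictlyBetween⇒< : ∀ {c} → StrictlyBetween e a b → a < c → b < c → e < c
    strictlyBetween⇒< (inj₁ (_ , e<b)) _   b<c = <-trans e<b b<c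
    strictlyBetween⇒< (inj₂ (_ , e<a)) a<c _   = <-trans e<a a<c

    strictlyBetween⇒> : ∀ {c} → StrictlyBetween e a b → c < a → c < b → c < e
    strictlyBetween⇒> (inj₁ (a<e , _)) c<a _   = <-trans c<a a<e
    strictlyBetween⇒> (inj₂ (b<e , _)) _   c<b = <-trans c<b b<e

  strictlyBetween-irrefl : ∀ {e a : Fin n} → ¬ StrictlyBetween e a a
  strictlyBetween-irrefl (inj₁ (a<e , e<a)) = <-asym a<e e<a
  strictlyBetween-irrefl (inj₂ (a<e , e<a)) = <-asym a<e e<a

  module _ {u v a b : Fin n} where

    strictlyBetween-raise : StrictlyBetween u a b → u < v →
                            (u < a → v < a) → (u < b → v < b) → StrictlyBetween v a b
    strictlyBetween-raise (inj₁ (a<u , u<b)) u<v _ raise = inj₁ (<-trans a<u u<v , raise u<b)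
    strictlyBetween-raise (inj₂ (b<u , u<a)) u<v raise _ = inj₂ (<-trans b<u u<v , raise u<a)

    strictlyBetween-raise′ : StrictlyBetween u a b → u < v →
                             ¬ (a < v × b < v) → v ≢ a → v ≢ b → StrictlyBetween v a b
    strictlyBetween-raise′ (inj₁ (a<u , u<b)) u<v ¬both _ v≢b =
      inj₁ (<-trans a<u u<v , ≤∧≢⇒< (ℕ.≮⇒≥ λ b<v → ¬both (<-trans a<u u<v , b<v)) v≢b)
    strictlyBetween-raise′ (inj₂ (b<u , u<a)) u<v ¬both v≢a _ =
      inj₂ (<-trans b<u u<v , ≤∧≢⇒< (ℕ.≮⇒≥ λ a<v → ¬both (a<v , <-trans b<u u<v)) v≢a)

    strictlyBetween-lower : StrictlyBetween v a b → u < v →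
                            (a < v → a < u) → (b < v → b < u) → StrictlyBetween u a b
    strictlyBetween-lower (inj₁ (a<v , v<b)) u<v lower _ = inj₁ (lower a<v , <-trans u<v v<b)
    strictlyBetween-lower (inj₂ (b<v , v<a)) u<v _ lower = inj₂ (lower b<v , <-trans u<v v<a)

    strictlyBetween-lower′ : StrictlyBetween v a b → u < v →
                             ¬ (u < a × u < b) → a ≢ u → b ≢ u → StrictlyBetween u a b
    strictlyBetween-lower′ (inj₁ (a<v , v<b)) u<v ¬both a≢u _ =
      inj₁ (≤∧≢⇒< (ℕ.≮⇒≥ λ u<a → ¬both (u<a , <-trans u<v v<b)) a≢u , <-trans u<v v<b)
    strictlyBetween-lower′ (inj₂ (b<v , v<a)) u<v ¬both _ b≢u =
      inj₂ (≤∧≢⇒< (ℕ.≮⇒≥ λ u<b → ¬both (<-trans u<v v<a , u<b)) b≢u , <-trans u<v v<a)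

LeftRegion RightRegion : ∀ {n} → Permutation′ n → (a b c d e : Fin n) → Set
LeftRegion  π a b c d e = (Before π a e × Before π e b) × StrictlyBetween e c d
RightRegion π a b c d e = (Before π c e × Before π e d) × StrictlyBetween e a b

weight : List Letter → ℕ → ℕ
weight m p = if does (m ≟LS LR) then p else 0

weight-mono : ∀ m {p q} → (m ≡ LR → p ℕ.≤ q) → weight m p ℕ.≤ weight m q
weight-mono m p≤q with m ≟LS LR
... | yes m≡LR = p≤q m≡LR
... | no _     = ℕ.z≤n

module _ {n : ℕ} (π : Permutation′ n) where

  lrPositionSum : Marking n → ℕ
  lrPositionSum M = sum λ e → weight (M e) (toℕ (pos π e))

  pos-injective : ∀ {a b} → pos π a ≡ pos π b → a ≡ b
  pos-injective eq = trans (sym (inverseʳ π)) (trans (cong (π ⟨$⟩ʳ_) eq) (inverseʳ π))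

  before⇒≢ : ∀ {a b} → Before π a b → a ≢ b
  before⇒≢ a<b refl = <-irrefl refl a<b

  left? : ∀ e → Dec (IsLeft π e)
  left? e = any? λ f → (e F.<? f) ×-dec before? π f e

  right? : ∀ e → Dec (IsRight π e)
  right? e = any? λ f → (f F.<? e) ×-dec before? π e f

  module Adjacent {u v : Fin n} (imm : ImmBefore π u v) where

    before : Before π u v
    before = ℕ.≤-reflexive (sym imm)

    pos≤u : ∀ {t} → Before π t v → pos π t ≤ pos π u
    pos≤u t<v = ℕ.≤-pred (subst (suc (toℕ (pos π _)) ℕ.≤_) imm t<v)

    v≤pos : ∀ {t} → Before π u t → pos π v ≤ pos π t
    v≤pos u<t = subst (ℕ._≤ toℕ (pos π _)) (sym imm) u<t

    before-u : ∀ {t} → Before π t v → t ≢ u → Before π t u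
    before-u t<v t≢u = ≤∧≢⇒< (pos≤u t<v) (t≢u ∘ pos-injective)

    after-v : ∀ {t} → Before π u t → t ≢ v → Before π v t
    after-v u<t t≢v = ≤∧≢⇒< (v≤pos u<t) (t≢v ∘ sym ∘ pos-injective)

  ascent-switchbacks : ∀ {u v} → ImmBefore π u v → u < v →
                       IsRight π u → IsLeft π v → IsLeft π u × IsRight π v
  ascent-switchbacks imm u<v (j , j<u , uj) (k , v<k , kv) =
      (k , <-trans u<v v<k , before-u kv (<⇒≢ (<-trans u<v v<k) ∘ sym))
    , (j , <-trans j<u u<v , after-v uj (<⇒≢ (<-trans j<u u<v)))
    where open Adjacent imm

  Conflict : Marking n → Fin n → Fin n → Set
  Conflict M u v = ImmBefore π u v × M u ≡ RL × M v ≡ LR × u < v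

  conflict? : ∀ M → Dec (∃₂ (Conflict M))
  conflict? M = any? λ u → any? λ v →
    (toℕ (pos π v) ℕ.≟ suc (toℕ (pos π u))) ×-dec (M u ≟LS RL) ×-dec (M v ≟LS LR) ×-dec (u F.<? v)

  module _ {M : Marking n} (mk : IsMarking π M) where

    twoLetters⇒switchback : ∀ {e x y} → M e ≡ x ∷ y ∷ [] → IsLeft π e × IsRight π e
    twoLetters⇒switchback {e} Me with left? e | right? e | mk e
    ... | yes l  | yes r  | _                  = l , r
    ... | yes l  | no ¬r  | (leftStraight , _) = contradiction (trans (sym Me) (leftStraight l ¬r)) λ ()
    ... | no ¬l  | yes r  | (_ , rightStraight , _) =
      contradiction (trans (sym Me) (rightStraight r ¬l)) λ ()
    ... | no ¬l  | no ¬r  | (_ , _ , _ , neither) = contradiction (trans (sym Me) (neither ¬l ¬r)) λ ()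

    startsWithR⇒right : ∀ {e} → StartsWith R (M e) → IsRight π e
    startsWithR⇒right {e} (_ , Me) with right? e | left? e | mk e
    ... | yes r | _     | _                  = r
    ... | no ¬r | yes l | (leftStraight , _) = contradiction (trans (sym Me) (leftStraight l ¬r)) λ ()
    ... | no ¬r | no ¬l | (_ , _ , _ , neither) = contradiction (trans (sym Me) (neither ¬l ¬r)) λ ()

    startsWithL⇒left : ∀ {e} → StartsWith L (M e) → IsLeft π e
    startsWithL⇒left {e} (_ , Me) with left? e | right? e | mk e
    ... | yes l | _     | _                       = l
    ... | no ¬l | yes r | (_ , rightStraight , _) = contradiction (trans (sym Me) (rightStraight r ¬l)) λ ()
    ... | no ¬l | no ¬r | (_ , _ , _ , neither)   = contradiction (trans (sym Me) (neither ¬l ¬r)) λ ()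

    switchbackMark : ∀ {e} → IsLeft π e → IsRight π e → M e ≡ LR ⊎ M e ≡ RL
    switchbackMark {e} = proj₁ (proj₂ (proj₂ (mk e)))

    switchback-startsWithR : ∀ {e} → IsLeft π e → IsRight π e → StartsWith R (M e) → M e ≡ RL
    switchback-startsWithR {e} l r (_ , Me) with switchbackMark l r
    ... | inj₁ Me≡LR = contradiction (trans (sym Me) Me≡LR) λ ()
    ... | inj₂ Me≡RL = Me≡RL

    switchback-startsWithL : ∀ {e} → IsLeft π e → IsRight π e → StartsWith L (M e) → M e ≡ LR
    switchback-startsWithL {e} l r (_ , Me) with switchbackMark l r
    ... | inj₁ Me≡LR = Me≡LR
    ... | inj₂ Me≡RL = contradiction (trans (sym Me) Me≡RL) λ ()

    conflictFree⇒aligned : ¬ ∃₂ (Conflict M) → IsAligned π M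
    conflictFree⇒aligned noConflict a b imm Ra Lb with <-cmp b a
    ... | tri< b<a _ _ = b<a , Adjacent.before imm
    ... | tri≈ _ b≡a _ = contradiction (subst (Before π a) b≡a (Adjacent.before imm)) (<-irrefl refl)
    ... | tri> _ _ a<b = contradiction
      (a , b , imm , switchback-startsWithR la ra Ra , switchback-startsWithL lb rb Lb , a<b) noConflict
      where
      ra = startsWithR⇒right Ra
      lb = startsWithL⇒left Lb
      la = proj₁ (ascent-switchbacks imm a<b ra lb)
      rb = proj₂ (ascent-switchbacks imm a<b ra lb)

    reindex-isMarking : (f : Fin n → Fin n) →
                        (∀ e → IsLeft π e ⇔ IsLeft π (f e)) → (∀ e → IsRight π e ⇔ IsRight π (f e)) →
                        IsMarking π (M ∘ f)
    reindex-isMarking f left⇔ right⇔ e with mk (f e)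
    ... | leftStraight , rightStraight , switchback , neither =
        (λ l ¬r → leftStraight (to (left⇔ e) l) (¬r ∘ from (right⇔ e)))
      , (λ r ¬l → rightStraight (to (right⇔ e) r) (¬l ∘ from (left⇔ e)))
      , (λ l r → switchback (to (left⇔ e) l) (to (right⇔ e) r))
      , (λ ¬l ¬r → neither (¬l ∘ from (left⇔ e)) (¬r ∘ from (right⇔ e)))

  reindex-isBalanced : ∀ {M} (σ : Permutation′ n) →
    (∀ {a b c d} → IsRec π a b c d → ∀ e → LeftRegion π a b c d e ⇔ LeftRegion π a b c d (σ ⟨$⟩ʳ e)) →
    (∀ {a b c d} → IsRec π a b c d → ∀ e → RightRegion π a b c d e ⇔ RightRegion π a b c d (σ ⟨$⟩ʳ e)) →
    IsBalanced π M → IsBalanced π (M ∘ (σ ⟨$⟩ʳ_))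
  reindex-isBalanced {M} σ left⇔ right⇔ bl a b c d rec = balanced , empty
    where
    M′ = M ∘ (σ ⟨$⟩ʳ_)

    leftSB⇔ : ∀ e → LeftSwitchback π M′ a b c d e ⇔ LeftSwitchback π M a b c d (σ ⟨$⟩ʳ e)
    leftSB⇔ e = mk⇔ (λ (m , l) → m , to (left⇔ rec e) l) (λ (m , l) → m , from (left⇔ rec e) l)

    rightSB⇔ : ∀ e → RightSwitchback π M′ a b c d e ⇔ RightSwitchback π M a b c d (σ ⟨$⟩ʳ e)
    rightSB⇔ e = mk⇔ (λ (m , r) → m , to (right⇔ rec e) r) (λ (m , r) → m , from (right⇔ rec e) r)

    balanced : Regular a b c d → RecBalanced π M′ a b c d
    balanced reg = begin
      #LeftSB π M′ a b c d  ≡⟨ length-filter-allFin-permute _ _ σ leftSB⇔ ⟩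
      #LeftSB π M a b c d   ≡⟨ proj₁ (bl a b c d rec) reg ⟩
      #RightSB π M a b c d  ≡⟨ length-filter-allFin-permute _ _ σ rightSB⇔ ⟨
      #RightSB π M′ a b c d ∎
      where open ≡-Reasoning

    empty : ¬ Regular a b c d → RecEmpty π M′ a b c d
    empty irr e = proj₁ (emptyM (σ ⟨$⟩ʳ e)) ∘ to (leftSB⇔ e) , proj₂ (emptyM (σ ⟨$⟩ʳ e)) ∘ to (rightSB⇔ e)
      where emptyM = proj₂ (bl a b c d rec) irr

  lrPositionSum-transpose-< : ∀ {M u v} → M u ≢ LR → M v ≡ LR → Before π u v →
                              lrPositionSum (M ∘ (transpose u v ⟨$⟩ʳ_)) ℕ.< lrPositionSum M
  lrPositionSum-transpose-< {M} {u} {v} Mu≢LR Mv≡LR u<v = begin-strict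
    sum (λ e → weight (M (σ e)) (P e))
      <⟨ sum-mono-< (λ e → weight-mono (M (σ e)) (moves-right e)) u strictly-at-u ⟩
    sum (λ e → weight (M (σ e)) (P (σ e)))
      ≡⟨ sum-permute (λ e → weight (M e) (P e)) (transpose u v) ⟨
    lrPositionSum M
      ∎
    where
    open ℕ.≤-Reasoning
    σ = transpose u v ⟨$⟩ʳ_

    P : Fin n → ℕ
    P e = toℕ (pos π e)

    moves-right : ∀ e → M (σ e) ≡ LR → P e ℕ.≤ P (σ e)
    moves-right e with e F.≟ u
    ... | yes refl = λ _ → ℕ.<⇒≤ u<v
    ... | no _ with e F.≟ v
    ...   | yes refl = λ Mu≡LR → contradiction Mu≡LR Mu≢LR
    ...   | no _     = λ _ → ℕ.≤-refl

    strictly-at-u : weight (M (σ u)) (P u) ℕ.< weight (M (σ u)) (P (σ u))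
    strictly-at-u with u F.≟ u
    ... | yes _ rewrite Mv≡LR = u<v
    ... | no u≢u = contradiction refl u≢u

module Resolution {n} (π : Permutation′ n) {M : Marking n} (mk : IsMarking π M) (bl : IsBalanced π M)
  {u v : Fin n} (imm : ImmBefore π u v) (Mu : M u ≡ RL) (Mv : M v ≡ LR) (u<v : u < v)
  {j : Fin n} (j<u : j < u) (uj : Before π u j) {k : Fin n} (v<k : v < k) (kv : Before π k v) where

  open Adjacent π imm

  vj : Before π v j
  vj = after-v uj (<⇒≢ (<-trans j<u u<v))

  ku : Before π k u
  ku = before-u kv (<⇒≢ (<-trans u<v v<k) ∘ sym)

  u-not-leftSwitchback : ∀ {a c d} → IsRec π a v c d → v < a → ¬ StrictlyBetween u c d
  u-not-leftSwitchback rec@((av , _) , _) v<a btw =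
    proj₁ (proj₂ (bl _ _ _ _ rec) (λ (a<v , _) → <-asym a<v v<a) u) (Mu , (au , before) , btw)
    where au = before-u av (<⇒≢ (<-trans u<v v<a) ∘ sym)

  v-not-rightSwitchback : ∀ {a b d} → IsRec π a b u d → d < u → ¬ StrictlyBetween v a b
  v-not-rightSwitchback rec@((_ , _ , ud) , _) d<u btw =
    proj₂ (proj₂ (bl _ _ _ _ rec) (λ (_ , u<d) → <-asym u<d d<u) v) (Mv , (before , vd) , btw)
    where vd = after-v ud (<⇒≢ (<-trans d<u u<v))

  u-between-below-v : ∀ {a c d} → Before π a v → v < a → Before π v c → Before π v d →
                      c < v → d < v → ¬ StrictlyBetween u c d
  u-between-below-v {a} {c} {d} av v<a vc vd c<v d<v btw with <-cmp (pos π c) (pos π d)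
  ... | tri< cd _ _ =
    u-not-leftSwitchback ((av , vc , cd) , (<-trans c<v v<a , c<v , <-trans d<v v<a , d<v)) v<a btw
  ... | tri≈ _ cd _ = strictlyBetween-irrefl (subst (StrictlyBetween u c) (sym (pos-injective π cd)) btw)
  ... | tri> _ _ dc =
    u-not-leftSwitchback ((av , vd , dc) , (<-trans d<v v<a , d<v , <-trans c<v v<a , c<v)) v<a
      (strictlyBetween-sym btw)

  v-between-above-u : ∀ {a b d} → Before π a u → Before π b u → u < a → u < b →
                      Before π u d → d < u → ¬ StrictlyBetween v a b
  v-between-above-u {a} {b} {d} au bu u<a u<b ud d<u btw with <-cmp (pos π a) (pos π b)
  ... | tri< ab _ _ =
    v-not-rightSwitchback ((ab , bu , ud) , (u<a , u<b , <-trans d<u u<a , <-trans d<u u<b)) d<u btw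
  ... | tri≈ _ ab _ = strictlyBetween-irrefl (subst (StrictlyBetween v a) (sym (pos-injective π ab)) btw)
  ... | tri> _ _ ba =
    v-not-rightSwitchback ((ba , au , ud) , (u<b , u<a , <-trans d<u u<b , <-trans d<u u<a)) d<u
      (strictlyBetween-sym btw)

  module _ {w x y z : Fin n} where

    leftRegion-u→v : IsRec π w x y z → LeftRegion π w x y z u → LeftRegion π w x y z v
    leftRegion-u→v ((_ , xy , yz) , (_ , y<x , _ , z<x)) ((wu , ux) , btu) =
      (<-trans wu before , after-v ux x≢v) , btv
      where
      vy : Before π v y
      vy = ℕ.≤-<-trans (v≤pos ux) xy
      vz = <-trans vy yz
      btv = strictlyBetween-raise′ btu u<v (λ (y<v , z<v) → u-between-below-v kv v<k vy vz y<v z<v btu)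
                                   (before⇒≢ π vy) (before⇒≢ π vz)
      x≢v = <⇒≢ (strictlyBetween⇒< btv y<x z<x) ∘ sym

    leftRegion-v→u : IsRec π w x y z → LeftRegion π w x y z v → LeftRegion π w x y z u
    leftRegion-v→u ((_ , xy , yz) , (y<w , _ , z<w , _)) ((wv , vx) , btv) =
      (wu , <-trans before vx) , strictlyBetween-lower btv u<v (below vy) (below (<-trans vy yz))
      where
      v<w = strictlyBetween⇒< btv y<w z<w
      wu = before-u wv (<⇒≢ (<-trans u<v v<w) ∘ sym)
      vy = <-trans vx xy
      below : ∀ {c} → Before π v c → c < v → c < u
      below {c} vc c<v with <-cmp c u
      ... | tri< c<u _ _ = c<u
      ... | tri≈ _ refl _ = contradiction vc (<-asym before)
      ... | tri> _ _ u<c = contradiction (inj₂ (j<u , u<c))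
                             (u-between-below-v wv v<w vc vj c<v (<-trans j<u u<v))

    rightRegion-u→v : IsRec π w x y z → RightRegion π w x y z u → RightRegion π w x y z v
    rightRegion-u→v ((wx , xy , _) , (_ , _ , z<w , z<x)) ((yu , uz) , btu) =
      (<-trans yu before , vz) , strictlyBetween-raise btu u<v (above (<-trans wx xy)) (above xy)
      where
      z<u = strictlyBetween⇒> btu z<w z<x
      vz = after-v uz (<⇒≢ (<-trans z<u u<v))
      above : ∀ {a} → Before π a y → u < a → v < a
      above {a} ay u<a with <-cmp v a
      ... | tri< v<a _ _ = v<a
      ... | tri≈ _ refl _ = contradiction (<-trans ay yu) (<-asym before)
      ... | tri> _ _ a<v = contradiction (inj₁ (a<v , v<k))
                             (v-between-above-u (<-trans ay yu) ku u<a (<-trans u<v v<k) uz z<u)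

    rightRegion-v→u : IsRec π w x y z → RightRegion π w x y z v → RightRegion π w x y z u
    rightRegion-v→u ((wx , xy , _) , (y<w , y<x , _ , _)) ((yv , vz) , btv) =
      (≤∧≢⇒< (pos≤u yv) (y≢u ∘ pos-injective π) , <-trans before vz) , btu
      where
      xu = ℕ.<-≤-trans xy (pos≤u yv)
      wu = <-trans wx xu
      ¬both : ¬ (u < w × u < x)
      ¬both (u<w , u<x) = v-between-above-u wu xu u<w u<x uj j<u btv
      btu = strictlyBetween-lower′ btv u<v ¬both (before⇒≢ π wu) (before⇒≢ π xu)
      y≢u : y ≢ u
      y≢u y≡u = ¬both (subst (_< w) y≡u y<w , subst (_< x) y≡u y<x)

  swapped : Marking n
  swapped = M ∘ (transpose u v ⟨$⟩ʳ_)

  swapped-isMarking : IsMarking π swapped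
  swapped-isMarking = reindex-isMarking π mk (transpose u v ⟨$⟩ʳ_)
    (transpose-⇔ (mk⇔ (λ _ → lv) (λ _ → proj₁ lu,rv)))
    (transpose-⇔ (mk⇔ (λ _ → proj₂ lu,rv) (λ _ → ru)))
    where
    ru : IsRight π u
    ru = j , j<u , uj
    lv : IsLeft π v
    lv = k , v<k , kv
    lu,rv = ascent-switchbacks π imm u<v ru lv

  swapped-isBalanced : IsBalanced π swapped
  swapped-isBalanced = reindex-isBalanced π (transpose u v)
    (λ rec → transpose-⇔ (mk⇔ (leftRegion-u→v rec) (leftRegion-v→u rec)))
    (λ rec → transpose-⇔ (mk⇔ (rightRegion-u→v rec) (rightRegion-v→u rec)))
    bl

  swapped-decreases : lrPositionSum π swapped ℕ.< lrPositionSum π M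
  swapped-decreases =
    lrPositionSum-transpose-< π (λ Mu≡LR → contradiction (trans (sym Mu) Mu≡LR) λ ()) Mv before

module _ {n : ℕ} (π : Permutation′ n) where

  resolveConflicts : ∀ M → Acc ℕ._<_ (lrPositionSum π M) → IsMarking π M → IsBalanced π M →
                     ∃ λ (M′ : Marking n) → IsMarking π M′ × IsAligned π M′ × IsBalanced π M′
  resolveConflicts M (acc smaller) mk bl with conflict? π M
  ... | no noConflict = M , mk , conflictFree⇒aligned π mk noConflict , bl
  ... | yes (u , v , imm , Mu , Mv , u<v)
    with twoLetters⇒switchback π mk Mu | twoLetters⇒switchback π mk Mv
  ...   | (_ , j , j<u , uj) | ((k , v<k , kv) , _) =
    resolveConflicts swapped (smaller swapped-decreases) swapped-isMarking swapped-isBalanced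
    where open Resolution π mk bl imm Mu Mv u<v j<u uj v<k kv

lemma9 : (n : ℕ) (π : Permutation′ n) (M : Marking n) →
         IsMarking π M → IsBalanced π M →
         ∃ λ (M′ : Marking n) → IsMarking π M′ × IsAligned π M′ × IsBalanced π M′
lemma9 n π M = resolveConflicts π M (<-wellFounded _)
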